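{- Let $A$ be a formula of $\mathbf{EQC}$, $\Gamma$ a finite set of formulas of $\mathbf{IQC}$ and $E\in\Gamma$. Then $\vdash_{\mathbf{IQC}}\neg_E\neg_E A^{(E)}_\Gamma\leftrightarrow A^{(E)}_\Gamma$.
   Context: $\mathbf{IQC}$ is intuitionistic first-order predicate calculus with equality, primitives $\vee,\wedge,\supset,\exists,\forall,\bot$. $\mathbf{EQC}$ is classical first-order predicate calculus with equality plus the S4 modal operator $\Box$. $\neg_E A$ denotes $A\supset E$. Flagg–Friedman translation: for a finite set $\Gamma$ of $\mathbf{IQC}$-formulas, the $\mathbf{IQC}$-formulas $B^{(E)}_\Gamma$ ($E\in\Gamma$, $B$ an $\mathbf{EQC}$-formula) are defined simultaneously by induction on $B$: $B^{(E)}_\Gamma=\neg_E\neg_E B$ for atomic $B$; $(A\vee B)^{(E)}_\Gamma=\neg_E\neg_E(A^{(E)}_\Gamma\vee B^{(E)}_\Gamma)$; $(A\wedge B)^{(E)}_\Gamma=A^{(E)}_\Gamma\wedge B^{(E)}_\Gamma$; $(A\supset B)^{(E)}_\Gamma=A^{(E)}_\Gamma\supset B^{(E)}_\Gamma$; $(\Box A)^{(E)}_\Gamma=\neg_E\neg_E\bigwedge_{C\in\Gamma}A^{(C)}_\Gamma$; $(\exists xA)^{(E)}_\Gamma=\neg_E\neg_E\exists x A^{(E)}_\Gamma$; $(\forall x A)^{(E)}_\Gamma=\forall x A^{(E)}_\Gamma$. -}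

module Defs where

open import Data.Nat using (ℕ; zero; suc)
open import Data.Vec using (Vec; []; _∷_)
open import Data.List using (List; []; _∷_; map)
open import Data.List.Membership.Propositional using (_∈_)

record Signature : Set₁ where
  field
    Fun  : Set
    fAr  : Fun → ℕ
    Pred : Set
    pAr  : Pred → ℕ

module Syntax (S : Signature) where
  open Signature S

  -- Terms, with de Bruijn indices for variables.
  data Term : Set where
    var : ℕ → Term
    fun : (f : Fun) → Vec Term (fAr f) → Term

  mutual
    substT : (ℕ → Term) → Term → Term
    substT σ (var x)    = σ x
    substT σ (fun f ts) = fun f (substTs σ ts)

    substTs : ∀ {n} → (ℕ → Term) → Vec Term n → Vec Term n
    substTs σ []       = []
    substTs σ (t ∷ ts) = substT σ t ∷ substTs σ ts

  shiftT : Term → Term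
  shiftT = substT (λ x → var (suc x))

  ⇑ : (ℕ → Term) → (ℕ → Term)
  ⇑ σ zero    = var zero
  ⇑ σ (suc x) = shiftT (σ x)

  ⟨_⟩ : Term → (ℕ → Term)
  ⟨ t ⟩ zero    = t
  ⟨ t ⟩ (suc x) = var x

  data Atom : Set where
    pred : (P : Pred) → Vec Term (pAr P) → Atom
    _≐_  : Term → Term → Atom

  substA : (ℕ → Term) → Atom → Atom
  substA σ (pred P ts) = pred P (substTs σ ts)
  substA σ (t ≐ u)     = substT σ t ≐ substT σ u

  infixr 6 _∧_
  infixr 5 _∨_
  infixr 4 _⊃_

  data Fm : Set where
    atom : Atom → Fm
    ⊥'   : Fm
    _∨_  : Fm → Fm → Fm
    _∧_  : Fm → Fm → Fm
    _⊃_  : Fm → Fm → Fm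
    ∃'   : Fm → Fm
    ∀'   : Fm → Fm

  data EFm : Set where
    atom : Atom → EFm
    ⊥'   : EFm
    _∨_  : EFm → EFm → EFm
    _∧_  : EFm → EFm → EFm
    _⊃_  : EFm → EFm → EFm
    ∃'   : EFm → EFm
    ∀'   : EFm → EFm
    □    : EFm → EFm

  substF : (ℕ → Term) → Fm → Fm
  substF σ (atom a) = atom (substA σ a)
  substF σ ⊥'       = ⊥'
  substF σ (A ∨ B)  = substF σ A ∨ substF σ B
  substF σ (A ∧ B)  = substF σ A ∧ substF σ B
  substF σ (A ⊃ B)  = substF σ A ⊃ substF σ B
  substF σ (∃' A)   = ∃' (substF (⇑ σ) A)
  substF σ (∀' A)   = ∀' (substF (⇑ σ) A)

  shiftF : Fm → Fm
  shiftF = substF (λ x → var (suc x))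

  _[_] : Fm → Term → Fm
  A [ t ] = substF ⟨ t ⟩ A

  ⊤' : Fm
  ⊤' = ⊥' ⊃ ⊥'

  _↔_ : Fm → Fm → Fm
  A ↔ B = (A ⊃ B) ∧ (B ⊃ A)

  ¬[_]_ : Fm → Fm → Fm
  ¬[ E ] A = A ⊃ E

  infix 2 _⊢_
  data _⊢_ : List Fm → Fm → Set where
    hyp  : ∀ {Δ A} → A ∈ Δ → Δ ⊢ A
    ⊥E   : ∀ {Δ A} → Δ ⊢ ⊥' → Δ ⊢ A
    ∧I   : ∀ {Δ A B} → Δ ⊢ A → Δ ⊢ B → Δ ⊢ A ∧ B
    ∧E₁  : ∀ {Δ A B} → Δ ⊢ A ∧ B → Δ ⊢ A
    ∧E₂  : ∀ {Δ A B} → Δ ⊢ A ∧ B → Δ ⊢ B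
    ∨I₁  : ∀ {Δ A B} → Δ ⊢ A → Δ ⊢ A ∨ B
    ∨I₂  : ∀ {Δ A B} → Δ ⊢ B → Δ ⊢ A ∨ B
    ∨E   : ∀ {Δ A B C} → Δ ⊢ A ∨ B → (A ∷ Δ) ⊢ C → (B ∷ Δ) ⊢ C → Δ ⊢ C
    ⊃I   : ∀ {Δ A B} → (A ∷ Δ) ⊢ B → Δ ⊢ A ⊃ B
    ⊃E   : ∀ {Δ A B} → Δ ⊢ A ⊃ B → Δ ⊢ A → Δ ⊢ B
    ∀I   : ∀ {Δ A} → map shiftF Δ ⊢ A → Δ ⊢ ∀' A
    ∀E   : ∀ {Δ A} → Δ ⊢ ∀' A → (t : Term) → Δ ⊢ A [ t ]
    ∃I   : ∀ {Δ A} (t : Term) → Δ ⊢ A [ t ] → Δ ⊢ ∃' A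
    ∃E   : ∀ {Δ A B} → Δ ⊢ ∃' A → (A ∷ map shiftF Δ) ⊢ shiftF B → Δ ⊢ B
    ≐I   : ∀ {Δ} (t : Term) → Δ ⊢ atom (t ≐ t)
    ≐E   : ∀ {Δ A t u} → Δ ⊢ atom (t ≐ u) → Δ ⊢ A [ t ] → Δ ⊢ A [ u ]

  -- Under a quantifier the bound variable is fresh for Γ and E, so Γ and E
  -- are shifted (de Bruijn weakening).  The big conjunction over C ∈ Γ is
  -- taken along the list Γ (empty conjunction = ⊤).
  mutual
    tr : List Fm → Fm → EFm → Fm
    tr Γ E (atom a) = ¬[ E ] ¬[ E ] atom a
    tr Γ E ⊥'       = ¬[ E ] ¬[ E ] ⊥'
    tr Γ E (A ∨ B)  = ¬[ E ] ¬[ E ] (tr Γ E A ∨ tr Γ E B)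
    tr Γ E (A ∧ B)  = tr Γ E A ∧ tr Γ E B
    tr Γ E (A ⊃ B)  = tr Γ E A ⊃ tr Γ E B
    tr Γ E (□ A)    = ¬[ E ] ¬[ E ] trAll Γ Γ A
    tr Γ E (∃' A)   = ¬[ E ] ¬[ E ] ∃' (tr (map shiftF Γ) (shiftF E) A)
    tr Γ E (∀' A)   = ∀' (tr (map shiftF Γ) (shiftF E) A)

    trAll : List Fm → List Fm → EFm → Fm
    trAll Γ []      A = ⊤'
    trAll Γ (C ∷ []) A = tr Γ C A
    trAll Γ (C ∷ Δ@(_ ∷ _)) A = tr Γ C A ∧ trAll Γ Δ A

{-# OPTIONS --safe #-}
-- Every clause of the translation either starts with ¬E¬E or is a conjunction,
-- implication or universal quantification of translations.  Formulas F with
-- ⊢ ¬E¬E F ⊃ F are closed under ∧, under A ⊃ (-) and under ∀ (with E weakened),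
-- and ¬E¬E X is always of this kind, so every translation is ¬E¬E-stable; the
-- converse F ⊃ ¬E¬E F holds for any F.
module Submission where

open import Defs
open import Data.Nat using (ℕ; zero; suc)
open import Data.Vec using (Vec; []; _∷_)
open import Data.List using (List; []; _∷_)
open import Data.List.Membership.Propositional using (_∈_)
open import Data.List.Relation.Unary.Any using (here; there)
open import Relation.Binary.PropositionalEquality using (_≡_; refl; cong; cong₂; subst; sym)
open Relation.Binary.PropositionalEquality.≡-Reasoning

module _ (S : Signature) where
  open Syntax S

  ↑ : ℕ → Term
  ↑ x = var (suc x)

  mutual
    substT-∘ : ∀ σ τ t → substT σ (substT τ t) ≡ substT (λ x → substT σ (τ x)) t
    substT-∘ σ τ (var x)    = refl
    substT-∘ σ τ (fun f ts) = cong (fun f) (substTs-∘ σ τ ts)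

    substTs-∘ : ∀ {n} σ τ (ts : Vec Term n) →
                substTs σ (substTs τ ts) ≡ substTs (λ x → substT σ (τ x)) ts
    substTs-∘ σ τ []       = refl
    substTs-∘ σ τ (t ∷ ts) = cong₂ _∷_ (substT-∘ σ τ t) (substTs-∘ σ τ ts)

  LeftInverse : (ℕ → Term) → (ℕ → Term) → Set
  LeftInverse σ τ = ∀ x → substT σ (τ x) ≡ var x

  mutual
    substT-leftInverse : ∀ {σ τ} → LeftInverse σ τ → ∀ t → substT σ (substT τ t) ≡ t
    substT-leftInverse inv (var x)    = inv x
    substT-leftInverse inv (fun f ts) = cong (fun f) (substTs-leftInverse inv ts)

    substTs-leftInverse : ∀ {σ τ n} → LeftInverse σ τ →
                          (ts : Vec Term n) → substTs σ (substTs τ ts) ≡ ts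
    substTs-leftInverse inv []       = refl
    substTs-leftInverse inv (t ∷ ts) =
      cong₂ _∷_ (substT-leftInverse inv t) (substTs-leftInverse inv ts)

  substA-leftInverse : ∀ {σ τ} → LeftInverse σ τ → ∀ a → substA σ (substA τ a) ≡ a
  substA-leftInverse inv (pred P ts) = cong (pred P) (substTs-leftInverse inv ts)
  substA-leftInverse inv (t ≐ u)     =
    cong₂ _≐_ (substT-leftInverse inv t) (substT-leftInverse inv u)

  ⇑-leftInverse : ∀ {σ τ} → LeftInverse σ τ → LeftInverse (⇑ σ) (⇑ τ)
  ⇑-leftInverse inv zero    = refl
  ⇑-leftInverse {σ} {τ} inv (suc x) = begin
    substT (⇑ σ) (shiftT (τ x))       ≡⟨ substT-∘ (⇑ σ) ↑ (τ x) ⟩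
    substT (λ y → shiftT (σ y)) (τ x) ≡⟨ sym (substT-∘ ↑ σ (τ x)) ⟩
    shiftT (substT σ (τ x))           ≡⟨ cong shiftT (inv x) ⟩
    var (suc x)                       ∎

  substF-leftInverse : ∀ {σ τ} → LeftInverse σ τ → ∀ F → substF σ (substF τ F) ≡ F
  substF-leftInverse inv (atom a) = cong atom (substA-leftInverse inv a)
  substF-leftInverse inv ⊥'       = refl
  substF-leftInverse inv (A ∨ B)  = cong₂ _∨_ (substF-leftInverse inv A) (substF-leftInverse inv B)
  substF-leftInverse inv (A ∧ B)  = cong₂ _∧_ (substF-leftInverse inv A) (substF-leftInverse inv B)
  substF-leftInverse inv (A ⊃ B)  = cong₂ _⊃_ (substF-leftInverse inv A) (substF-leftInverse inv B)
  substF-leftInverse inv (∃' A)   = cong ∃' (substF-leftInverse (⇑-leftInverse inv) A)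
  substF-leftInverse inv (∀' A)   = cong ∀' (substF-leftInverse (⇑-leftInverse inv) A)

  instantiate-⇑shift : ∀ B → substF (⇑ ↑) B [ var zero ] ≡ B
  instantiate-⇑shift = substF-leftInverse inv
    where
    inv : LeftInverse ⟨ var zero ⟩ (⇑ ↑)
    inv zero    = refl
    inv (suc x) = refl

  v0 : ∀ {Δ A} → (A ∷ Δ) ⊢ A
  v0 = hyp (here refl)

  v1 : ∀ {Δ A B} → (B ∷ A ∷ Δ) ⊢ A
  v1 = hyp (there (here refl))

  v2 : ∀ {Δ A B C} → (C ∷ B ∷ A ∷ Δ) ⊢ A
  v2 = hyp (there (there (here refl)))

  -- Quantifying over every context replaces weakening of derivations.
  Stable : Fm → Fm → Set
  Stable E F = ∀ {Δ} → Δ ⊢ (¬[ E ] ¬[ E ] F) ⊃ F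

  ¬¬-intro : ∀ {Δ} E F → Δ ⊢ F ⊃ ¬[ E ] ¬[ E ] F
  ¬¬-intro E F = ⊃I (⊃I (⊃E v0 v1))

  Stable-¬¬ : ∀ E X → Stable E (¬[ E ] ¬[ E ] X)
  Stable-¬¬ E X = ⊃I (⊃I (⊃E v1 (⊃I (⊃E v0 v1))))

  Stable-∧ : ∀ {E A B} → Stable E A → Stable E B → Stable E (A ∧ B)
  Stable-∧ sA sB = ⊃I (∧I (⊃E sA (⊃I (⊃E v1 (⊃I (⊃E v1 (∧E₁ v0))))))
                          (⊃E sB (⊃I (⊃E v1 (⊃I (⊃E v1 (∧E₂ v0)))))))

  Stable-⊃ : ∀ {E A B} → Stable E B → Stable E (A ⊃ B)
  Stable-⊃ sB = ⊃I (⊃I (⊃E sB (⊃I (⊃E v2 (⊃I (⊃E v1 (⊃E v0 v2)))))))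

  Stable-∀ : ∀ {E B} → Stable (shiftF E) B → Stable E (∀' B)
  Stable-∀ {B = B} sB = ⊃I (∀I (⊃E sB (⊃I (⊃E v1 (⊃I (⊃E v1 B-at-fresh))))))
    where
    B-at-fresh : ∀ {Δ} → (∀' (substF (⇑ ↑) B) ∷ Δ) ⊢ B
    B-at-fresh {Δ} = subst ((∀' (substF (⇑ ↑) B) ∷ Δ) ⊢_) (instantiate-⇑shift B)
                           (∀E v0 (var zero))

  tr-stable : ∀ A Γ E → Stable E (tr Γ E A)
  tr-stable (atom a) Γ E = Stable-¬¬ _ _
  tr-stable ⊥'       Γ E = Stable-¬¬ _ _
  tr-stable (A ∨ B)  Γ E = Stable-¬¬ _ _
  tr-stable (A ∧ B)  Γ E = Stable-∧ (tr-stable A Γ E) (tr-stable B Γ E)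
  tr-stable (A ⊃ B)  Γ E = Stable-⊃ (tr-stable B Γ E)
  tr-stable (∃' A)   Γ E = Stable-¬¬ _ _
  tr-stable (∀' A)   Γ E = Stable-∀ (tr-stable A _ _)
  tr-stable (□ A)    Γ E = Stable-¬¬ _ _

  Stable⇒¬¬↔ : ∀ {E F Δ} → Stable E F → Δ ⊢ (¬[ E ] ¬[ E ] F) ↔ F
  Stable⇒¬¬↔ {E} {F} sF = ∧I sF (¬¬-intro E F)

lemma4p1 : (S : Signature) → let open Syntax S in
    (A : EFm) (Γ : List Fm) (E : Fm) → E ∈ Γ →
      [] ⊢ ((¬[ E ] ¬[ E ] tr Γ E A) ↔ tr Γ E A)
lemma4p1 S A Γ E _ = Stable⇒¬¬↔ S (tr-stable S A Γ E)
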